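{- Let $G$ be a planar graph of maximum degree at most $4$ embedded in the plane with each vertex $v$ at a point $(x_v,y_v)\in\mathbb{Z}^2$ (distinct vertices at distinct points) and each edge drawn as a polyline of segments lying on lines $x=i$ or $y=j$ for integers $i,j$, without crossings. For an edge $uv$ let $M(u,v)=|x_u-x_v|+|y_u-y_v|$. Let $G'$ be obtained from $G$ by replacing every edge $uv$, with $\alpha=M(u,v)$, by new vertices $\ell_1,s_1,r_1,\dots,\ell_\alpha,s_\alpha,r_\alpha$ (distinct for each edge), where each $\ell_i s_i r_i$ forms a triangle, together with the edges $u\ell_1$, $r_\alpha v$ and $r_i\ell_{i+1}$ for $i\in[\alpha-1]$. Let $k$ be a positive integer and $k'=k+\sum_{uv\in E(G)}M(u,v)$. Then $G$ has a spanning tree admitting a vertex cover of size at most $k$ if and only if $G'$ has a spanning tree admitting a vertex cover of size at most $k'$.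
   Context: A vertex cover of a tree $T$ is a set of vertices containing at least one endpoint of every edge of $T$. -}

module Defs where

open import Data.Nat using (ℕ; zero; suc; _+_; _≤_)
open import Data.Integer as ℤ using (ℤ; ∣_∣; _-_)
open import Data.Fin using (Fin; toℕ) renaming (zero to f0; suc to fs)
open import Data.Product using (Σ; ∃; _×_; _,_; proj₁; proj₂; uncurry)
open import Data.Sum using (_⊎_; inj₁; inj₂)
open import Data.List using (List; []; _∷_; _++_; length; lookup; filter)
open import Data.List.Membership.Propositional using (_∈_; _∉_)
open import Data.List.Relation.Unary.All using (All)
open import Data.List.Relation.Unary.Any using (Any)
open import Data.List.Relation.Unary.Unique.Propositional using (Unique)
open import Relation.Binary.PropositionalEquality using (_≡_; _≢_)
open import Relation.Binary.Construct.Closure.ReflexiveTransitive using (Star)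
open import Relation.Nullary using (¬_)
open import Relation.Nullary.Decidable using (_⊎-dec_)
import Data.Fin.Properties as FinP

record Graph : Set₁ where
  field
    V : Set
    E : V → V → Set          -- edge relation (an edge uv may be recorded in either orientation)

segs : ∀ {A : Set} → List A → List (A × A)
segs [] = []
segs (p ∷ []) = []
segs (p ∷ q ∷ r) = (p , q) ∷ segs (q ∷ r)

module _ (G : Graph) where
  open Graph G

  Adj : List (V × V) → V → V → Set
  Adj T u v = (u , v) ∈ T ⊎ (v , u) ∈ T

  IsCycle : List (V × V) → V → List V → Set
  IsCycle T c cs = (2 ≤ length cs) × Unique (c ∷ cs)
                 × All (uncurry (Adj T)) (segs (c ∷ cs ++ c ∷ []))

  SpanningTree : List (V × V) → Set
  SpanningTree T = All (uncurry E) T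
                 × (∀ u v → Star (Adj T) u v)
                 × (∀ c cs → ¬ IsCycle T c cs)

  VertexCover : List (V × V) → List V → Set
  VertexCover T C = ∀ u v → (u , v) ∈ T → u ∈ C ⊎ v ∈ C

  HasSTwithVC : ℕ → Set
  HasSTwithVC k = Σ (List (V × V)) λ T → SpanningTree T
                × Σ (List V) λ C → Unique C × length C ≤ k × VertexCover T C

Pt : Set
Pt = ℤ × ℤ

graphOf : (n : ℕ) → List (Fin n × Fin n) → Graph
graphOf n Es = record { V = Fin n ; E = λ u v → (u , v) ∈ Es }

SimpleEdgeList : ∀ {n} → List (Fin n × Fin n) → Set
SimpleEdgeList {n} Es = Unique Es
  × (∀ u v → (u , v) ∈ Es → u ≢ v)
  × (∀ u v → (u , v) ∈ Es → (v , u) ∉ Es)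

degree : ∀ {n} → List (Fin n × Fin n) → Fin n → ℕ
degree Es v = length (filter (λ e → (proj₁ e FinP.≟ v) ⊎-dec (proj₂ e FinP.≟ v)) Es)

M : ∀ {n} → (Fin n → Pt) → Fin n → Fin n → ℕ
M pos u v = ∣ proj₁ (pos u) - proj₁ (pos v) ∣ + ∣ proj₂ (pos u) - proj₂ (pos v) ∣

-- Orthogonal grid drawings.  A polyline is its list of bend points;
-- all bends lie on intersections of grid lines, hence in ℤ².

Aligned : Pt → Pt → Set
Aligned p q = proj₁ p ≡ proj₁ q ⊎ proj₂ p ≡ proj₂ q

Between : ℤ → ℤ → ℤ → Set
Between a b c = (a ℤ.≤ c × c ℤ.≤ b) ⊎ (b ℤ.≤ c × c ℤ.≤ a)

OnSeg : Pt → Pt → Pt → Set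
OnSeg q p p' =
    (proj₁ q ≡ proj₁ p × proj₁ p ≡ proj₁ p' × Between (proj₂ p) (proj₂ p') (proj₂ q))
  ⊎ (proj₂ q ≡ proj₂ p × proj₂ p ≡ proj₂ p' × Between (proj₁ p) (proj₁ p') (proj₁ q))

OnPoly : Pt → List Pt → Set
OnPoly q ps = Any (λ s → OnSeg q (proj₁ s) (proj₂ s)) (segs ps)

module _ {n : ℕ} (Es : List (Fin n × Fin n)) where
  src tgt : Fin (length Es) → Fin n
  src e = proj₁ (lookup Es e)
  tgt e = proj₂ (lookup Es e)

  IsEnd : Fin n → Fin (length Es) → Set
  IsEnd w e = w ≡ src e ⊎ w ≡ tgt e

  record OrthoDrawing (pos : Fin n → Pt) : Set where
    field
      bends : Fin (length Es) → List Pt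
    route : Fin (length Es) → List Pt
    route e = pos (src e) ∷ bends e ++ pos (tgt e) ∷ []
    field
      axisParallel : ∀ e → All (uncurry Aligned) (segs (route e))
      avoidsVertices : ∀ e w → OnPoly (pos w) (route e) → IsEnd w e
      noCrossing : ∀ e f → e ≢ f → ∀ q → OnPoly q (route e) → OnPoly q (route f)
                   → Σ (Fin n) λ w → q ≡ pos w × IsEnd w e × IsEnd w f

-- The graph G': each edge e = uv (α = M(u,v)) is replaced by vertices
-- ℓ_i, s_i, r_i (i = 0 .. α-1; tag 0 = ℓ, 1 = s, 2 = r).

module _ {n : ℕ} (Es : List (Fin n × Fin n)) (pos : Fin n → Pt) where
  α : Fin (length Es) → ℕ
  α e = M pos (src Es e) (tgt Es e)

  V′ : Set
  V′ = Fin n ⊎ Σ (Fin (length Es)) λ e → Fin (α e) × Fin 3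

  new : ∀ e → Fin (α e) → Fin 3 → V′
  new e i t = inj₂ (e , i , t)

  data E′ : V′ → V′ → Set where
    ℓs   : ∀ e i → E′ (new e i f0) (new e i (fs f0))
    sr   : ∀ e i → E′ (new e i (fs f0)) (new e i (fs (fs f0)))
    rℓ   : ∀ e i → E′ (new e i (fs (fs f0))) (new e i f0)
    first : ∀ e (i : Fin (α e)) → toℕ i ≡ 0 → E′ (inj₁ (src Es e)) (new e i f0)
    last  : ∀ e (i : Fin (α e)) → suc (toℕ i) ≡ α e → E′ (new e i (fs (fs f0))) (inj₁ (tgt Es e))
    link  : ∀ e (i j : Fin (α e)) → suc (toℕ i) ≡ toℕ j → E′ (new e i (fs (fs f0))) (new e j f0)

  G′ : Graph
  G′ = record { V = V′ ; E = E′ }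

{-# OPTIONS --safe #-}

-- A spanning tree with vertex cover C exists iff the edges having an endpoint in C
-- connect the whole graph: those edges contain a spanning tree (grown by Prim's
-- algorithm), and conversely every tree edge is covered.  So it suffices to move such
-- connecting covers between G and G′, trading size k for k + ΣM.
--
-- From G to G′: for an edge uv put r_i into C′ for every triangle of its gadget if
-- u ∈ C, and ℓ_i otherwise.  Then every gadget vertex is joined to u by covered
-- edges, and so is v whenever uv is covered by C.
--
-- From G′ to G: both neighbours of s_i lie in its triangle, so every triangle meets
-- C′; fix a representative in each.  Let C consist of the base points (the vertex
-- itself, or the source u of the gadget) of the other vertices of C′, so that
-- |C| ≤ |C′| − ΣM.  If uv is not covered by C, each triangle of its gadget meets C′
-- only in its representative; sending the triangles before the first ℓ_i ∉ C′ to u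
-- and the others to v then maps every covered gadget edge to a single vertex.  If uv
-- is covered, any map of the gadget into {u, v} will do.  Hence covered paths in G′
-- contract to covered paths in G.

module Submission where

open import Defs
open import Data.Empty using (⊥; ⊥-elim)
open import Data.Fin as Fin using (Fin; toℕ)
open import Data.Fin.Induction using (<-weakInduction)
import Data.Fin.Properties as Fin
open import Data.Integer using (∣_∣; _-_)
import Data.Integer.Properties as ℤ
open import Data.List using (List; []; _∷_; _++_; length; map; filter; deduplicate; concat; tabulate; allFin; lookup)
open import Data.List.Membership.Propositional using (_∈_; _∉_; find)
open import Data.List.Membership.Propositional.Properties
  using ( ∈-lookup; ∈-map⁺; ∈-map⁻; ∈-deduplicate⁺; ∈-filter⁺; ∈-filter⁻; ∈-++⁺ˡ; ∈-++⁺ʳ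
        ; ∈-concat⁺′; ∈-tabulate⁺; ∈-tabulate⁻; ∈-allFin)
open import Data.List.Properties
  using ( filter-notAll; length-++; length-map; length-deduplicate; length-tabulate; map-tabulate
        ; tabulate-cong; tabulate-lookup)
open import Data.List.Relation.Binary.Subset.Propositional using (_⊆_)
open import Data.List.Relation.Unary.All as All using (All; []; _∷_)
open import Data.List.Relation.Unary.All.Properties as All using (¬Any⇒All¬; ++⁺)
import Data.List.Relation.Unary.AllPairs.Properties as AllPairs
open import Data.List.Relation.Unary.Any as Any using (Any; here; there; any?)
open import Data.List.Relation.Unary.Any.Properties as Any using (¬Any[])
open import Data.List.Relation.Unary.Unique.Propositional using (Unique; []; _∷_)
import Data.List.Relation.Unary.Unique.Propositional.Properties as Unique
open import Data.List.Relation.Unary.Unique.DecPropositional.Properties using (deduplicate-!)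
open import Data.Nat using (ℕ; zero; suc; _+_; _≤_; z≤n; s≤s)
open import Data.Nat.ListAction using (sum)
import Data.Nat.Properties as ℕ
open import Data.Product as Product using (Σ; ∃; ∃₂; _×_; _,_; proj₁; proj₂; uncurry)
open import Data.Product.Properties using () renaming (≡-dec to Σ-≡-dec)
open import Data.Sum as Sum using (_⊎_; inj₁; inj₂; swap)
open import Data.Sum.Properties using (inj₁-injective) renaming (≡-dec to ⊎-≡-dec)
open import Function using (_∘_)
open import Function.Bundles using (_⇔_; mk⇔)
open import Function.Definitions using (Injective)
open import Level using (0ℓ)
open import Relation.Binary.Construct.Closure.Equivalence as EqClosure using (EqClosure)
open import Relation.Binary.Construct.Closure.ReflexiveTransitive as Star using (Star; ε; _◅_; _◅◅_)
open import Relation.Binary.Construct.Closure.Symmetric using (SymClosure; fwd; bwd)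
open import Relation.Binary.Definitions using (DecidableEquality)
open import Relation.Binary.PropositionalEquality
  using (_≡_; _≢_; refl; sym; trans; cong; cong₂; subst; module ≡-Reasoning)
open import Relation.Nullary using (¬_; Dec; yes; no)
open import Relation.Nullary.Decidable using (_×-dec_; _⊎-dec_; _→-dec_; ¬?)
open import Relation.Unary using (Pred; Decidable)

module _ {A : Set} where

  Unique-⊆⇒length≤ : DecidableEquality A → ∀ {xs ys : List A}
    → Unique xs → xs ⊆ ys → length xs ≤ length ys
  Unique-⊆⇒length≤ _≟_ {[]} [] _ = z≤n
  Unique-⊆⇒length≤ _≟_ {x ∷ xs} {ys} (x∉xs ∷ uxs) sub =
    ℕ.≤-trans (s≤s (Unique-⊆⇒length≤ _≟_ uxs xs⊆ys-x))
              (filter-notAll ≢x? ys (Any.map (λ { refl x≢x → x≢x refl }) (sub (here refl))))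
    where
    ≢x? : Decidable (_≢ x)
    ≢x? y = ¬? (y ≟ x)
    xs⊆ys-x : xs ⊆ filter ≢x? ys
    xs⊆ys-x y∈xs = ∈-filter⁺ ≢x? (sub (there y∈xs)) (λ y≡x → All.lookup x∉xs y∈xs (sym y≡x))

  length-filter+length-filter¬ : ∀ {P : Pred A 0ℓ} (P? : Decidable P) xs
    → length (filter P? xs) + length (filter (¬? ∘ P?) xs) ≡ length xs
  length-filter+length-filter¬ P? [] = refl
  length-filter+length-filter¬ P? (x ∷ xs) with P? x
  ... | yes _ = cong suc (length-filter+length-filter¬ P? xs)
  ... | no _  = trans (ℕ.+-suc _ _) (cong suc (length-filter+length-filter¬ P? xs))

toℕ-induction : ∀ {m} (P : Fin m → Set) → (∀ i → toℕ i ≡ 0 → P i)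
  → (∀ i j → suc (toℕ i) ≡ toℕ j → P i → P j) → ∀ i → P i
toℕ-induction {suc _} P base step =
  <-weakInduction P (base Fin.zero refl)
    (λ i → step (Fin.inject₁ i) (Fin.suc i) (cong suc (Fin.toℕ-inject₁ i)))

∃-toℕ≡pred : ∀ {m} → 1 ≤ m → ∃ λ (i : Fin m) → suc (toℕ i) ≡ m
∃-toℕ≡pred {suc m} _ = Fin.fromℕ m , cong suc (Fin.toℕ-fromℕ m)

length-concat : ∀ {A : Set} (xss : List (List A)) → length (concat xss) ≡ sum (map length xss)
length-concat [] = refl
length-concat (xs ∷ xss) = trans (length-++ xs) (cong (length xs +_) (length-concat xss))

module _ (G : Graph) where
  open Graph G

  Walk : List (V × V) → List V → Set
  Walk T xs = All (uncurry (Adj G T)) (segs xs)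

  TwoNeighbours : List (V × V) → V → Set
  TwoNeighbours T b = ∃₂ λ p q → p ≢ q × Adj G T b p × Adj G T b q

  Acyclic : List (V × V) → Set
  Acyclic T = ∀ c cs → ¬ IsCycle G T c cs

  private
    lastOf : V → List V → V
    lastOf x [] = x
    lastOf x (y ∷ ys) = lastOf y ys

    lastOf∈ : ∀ x xs → lastOf x xs ∈ x ∷ xs
    lastOf∈ x [] = here refl
    lastOf∈ x (y ∷ ys) = there (lastOf∈ y ys)

    Walk-last : ∀ {T} x xs c → Walk T (x ∷ xs ++ c ∷ []) → Adj G T (lastOf x xs) c
    Walk-last x [] c (a ∷ _) = a
    Walk-last x (y ∷ ys) c (_ ∷ as) = Walk-last y ys c as

  Walk-interior : ∀ {T} p ys q → Unique (p ∷ ys) → q ∉ ys → (p ≡ q → 2 ≤ length ys)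
    → Walk T (p ∷ ys ++ q ∷ []) → ∀ {b} → b ∈ ys → TwoNeighbours T b
  Walk-interior p (y ∷ []) q _ _ short (a ∷ a′ ∷ _) (here refl) =
    p , q , (λ { refl → ℕ.<-irrefl refl (short refl) }) , swap a , a′
  Walk-interior p (y ∷ z ∷ ys) q ((_ ∷ p≢z ∷ _) ∷ _) _ _ (a ∷ a′ ∷ _) (here refl) =
    p , z , p≢z , swap a , a′
  Walk-interior p (y ∷ ys) q (_ ∷ uys) q∉ _ (_ ∷ as) (there b∈ys) =
    Walk-interior y ys q uys (q∉ ∘ there) (λ { refl → ⊥-elim (q∉ (here refl)) }) as b∈ys

  IsCycle⇒TwoNeighbours : ∀ {T c cs b} → IsCycle G T c cs → b ∈ c ∷ cs → TwoNeighbours T b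
  IsCycle⇒TwoNeighbours {cs = x ∷ y ∷ ys} (_ , (_ ∷ x∉ ∷ _) , a ∷ as) (here refl) =
    x , lastOf y ys , All.lookup x∉ (lastOf∈ y ys) , a , swap (Walk-last x (y ∷ ys) _ as)
  IsCycle⇒TwoNeighbours {cs = _ ∷ []} (s≤s () , _) (here refl)
  IsCycle⇒TwoNeighbours {c = c} {cs} (long , u@(c∉ ∷ _) , as) (there b∈cs) =
    Walk-interior c cs c u (λ c∈ → All.lookup c∉ c∈ refl) (λ _ → long) as b∈cs

  Joins : V × V → V → V → Set
  Joins e a b = e ≡ (a , b) ⊎ e ≡ (b , a)

  Fresh : List (V × V) → V → Set
  Fresh F b = ∀ {x y} → (x , y) ∈ F → x ≢ b × y ≢ b

  private
    Walk-restrict : ∀ {T F} {Q : V → Set} → (∀ {x y} → Q x → Q y → Adj G T x y → Adj G F x y)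
      → ∀ {xs} → All Q xs → Walk T xs → Walk F xs
    Walk-restrict f [] [] = []
    Walk-restrict f (_ ∷ []) [] = []
    Walk-restrict f (qx ∷ qy ∷ qs) (a ∷ as) = f qx qy a ∷ Walk-restrict f (qy ∷ qs) as

    leaf-neighbour : ∀ {F e a b w} → Fresh F b → a ≢ b → Joins e a b → Adj G (e ∷ F) b w → w ≡ a
    leaf-neighbour _ a≢b (inj₁ refl) (inj₁ (here refl)) = ⊥-elim (a≢b refl)
    leaf-neighbour _ _   (inj₂ refl) (inj₁ (here refl)) = refl
    leaf-neighbour _ _   (inj₁ refl) (inj₂ (here refl)) = refl
    leaf-neighbour _ a≢b (inj₂ refl) (inj₂ (here refl)) = ⊥-elim (a≢b refl)
    leaf-neighbour fresh _ _ (inj₁ (there p)) = ⊥-elim (proj₁ (fresh p) refl)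
    leaf-neighbour fresh _ _ (inj₂ (there p)) = ⊥-elim (proj₂ (fresh p) refl)

    away-from-leaf : ∀ {F e a b x y} → Joins e a b → Adj G (e ∷ F) x y → x ≢ b → y ≢ b → Adj G F x y
    away-from-leaf (inj₁ refl) (inj₁ (here refl)) _ y≢b = ⊥-elim (y≢b refl)
    away-from-leaf (inj₂ refl) (inj₁ (here refl)) x≢b _ = ⊥-elim (x≢b refl)
    away-from-leaf (inj₁ refl) (inj₂ (here refl)) x≢b _ = ⊥-elim (x≢b refl)
    away-from-leaf (inj₂ refl) (inj₂ (here refl)) _ y≢b = ⊥-elim (y≢b refl)
    away-from-leaf _ (inj₁ (there p)) _ _ = inj₁ p
    away-from-leaf _ (inj₂ (there p)) _ _ = inj₂ p

  module _ (_≟_ : DecidableEquality V) where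
    open import Data.List.Membership.DecPropositional _≟_ using (_∈?_)

    Acyclic-addLeaf : ∀ {F e a b} → Acyclic F → Fresh F b → a ≢ b → Joins e a b → Acyclic (e ∷ F)
    Acyclic-addLeaf {b = b} acyclic fresh a≢b joins c cs cycle@(long , u , walk) with b ∈? (c ∷ cs)
    ... | yes b∈ =
      let p , q , p≢q , bp , bq = IsCycle⇒TwoNeighbours cycle b∈
      in p≢q (trans (leaf-neighbour fresh a≢b joins bp) (sym (leaf-neighbour fresh a≢b joins bq)))
    ... | no b∉ with All.map (λ b≢z z≡b → b≢z (sym z≡b)) (¬Any⇒All¬ _ b∉)
    ...   | c≢b ∷ cs≢b =
      acyclic c cs (long , u , Walk-restrict (λ x≢b y≢b a → away-from-leaf joins a x≢b y≢b)
                                             (c≢b ∷ ++⁺ cs≢b (c≢b ∷ [])) walk)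

    Acyclic-[] : Acyclic []
    Acyclic-[] _ [] (() , _)
    Acyclic-[] _ (_ ∷ _) (_ , _ , inj₁ () ∷ _)
    Acyclic-[] _ (_ ∷ _) (_ , _ , inj₂ () ∷ _)

    module Prim (vertices : List V) (complete : ∀ v → v ∈ vertices) (S : List (V × V)) (root : V)
                (reachable : ∀ v → Star (Adj G S) root v) where

      record Tree (R : List V) : Set where
        field
          edges : List (V × V)
          edges⊆S : edges ⊆ S
          inside : ∀ {x y} → (x , y) ∈ edges → x ∈ R × y ∈ R
          root∈ : root ∈ R
          reach : ∀ {x} → x ∈ R → Star (Adj G edges) root x
          acyclic : Acyclic edges

      Crosses : List V → V × V → Set
      Crosses R (x , y) = (x ∈ R × y ∉ R) ⊎ (y ∈ R × x ∉ R)

      crosses? : ∀ R → Decidable (Crosses R)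
      crosses? R (x , y) = (x ∈? R ×-dec ¬? (y ∈? R)) ⊎-dec (y ∈? R ×-dec ¬? (x ∈? R))

      addLeaf : ∀ {R e a b} → Tree R → e ∈ S → a ∈ R → b ∉ R → Joins e a b → Tree (b ∷ R)
      addLeaf {R} {e} {a} {b} t e∈S a∈ b∉ joins = record
        { edges = e ∷ edges
        ; edges⊆S = λ { (here refl) → e∈S ; (there p) → edges⊆S p }
        ; inside = λ { (here refl) → ends joins ; (there p) → Product.map there there (inside p) }
        ; root∈ = there root∈
        ; reach = λ { (here refl) → Star.map there⊎ (reach a∈) ◅◅ adj joins ◅ ε
                    ; (there x∈) → Star.map there⊎ (reach x∈) }
        ; acyclic = Acyclic-addLeaf acyclic fresh (λ { refl → b∉ a∈ }) joins
        }
        where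
        open Tree t
        there⊎ : ∀ {x y} → Adj G edges x y → Adj G (e ∷ edges) x y
        there⊎ = Sum.map there there
        ends : ∀ {e} → Joins e a b → proj₁ e ∈ b ∷ R × proj₂ e ∈ b ∷ R
        ends (inj₁ refl) = there a∈ , here refl
        ends (inj₂ refl) = here refl , there a∈
        adj : ∀ {e} → Joins e a b → Adj G (e ∷ edges) a b
        adj (inj₁ refl) = inj₁ (here refl)
        adj (inj₂ refl) = inj₂ (here refl)
        fresh : Fresh edges b
        fresh p = (λ { refl → b∉ (proj₁ (inside p)) }) , (λ { refl → b∉ (proj₂ (inside p)) })

      grow : ∀ {R e} → Tree R → e ∈ S → Crosses R e → ∃ λ b → b ∉ R × Tree (b ∷ R)
      grow t e∈S (inj₁ (x∈ , y∉)) = _ , y∉ , addLeaf t e∈S x∈ y∉ (inj₁ refl)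
      grow t e∈S (inj₂ (y∈ , x∉)) = _ , x∉ , addLeaf t e∈S y∈ x∉ (inj₂ refl)

      closed : ∀ {R} → ¬ Any (Crosses R) S → ∀ {x y} → Star (Adj G S) x y → x ∈ R → y ∈ R
      closed nc ε x∈ = x∈
      closed {R} nc (_◅_ {i = x} {j = z} a p) x∈ with z ∈? R
      ... | yes z∈ = closed nc p z∈
      ... | no z∉ = ⊥-elim (nc (leaves a))
        where
        leaves : Adj G S x z → Any (Crosses R) S
        leaves (inj₁ xz∈S) = Any.map (λ { refl → inj₁ (x∈ , z∉) }) xz∈S
        leaves (inj₂ zx∈S) = Any.map (λ { refl → inj₂ (x∈ , z∉) }) zx∈S

      extend : ∀ {R} → Tree R → ¬ Any (Crosses R) S ⊎ ∃ λ b → b ∉ R × Tree (b ∷ R)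
      extend {R} t with any? (crosses? R) S
      ... | no nc = inj₁ nc
      ... | yes cr = let _ , e∈S , crosses = find cr in inj₂ (grow t e∈S crosses)

      loop : ∀ fuel {R} → Unique R → length vertices ≤ length R + fuel → Tree R
        → ∃ λ T → T ⊆ S × (∀ v → Star (Adj G T) root v) × Acyclic T
      loop fuel uR bound t with extend t
      loop _ _ _ t | inj₁ nc = edges , edges⊆S , (λ v → reach (closed nc (reachable v) root∈)) , acyclic
        where open Tree t
      loop zero {R} uR bound _ | inj₂ (b , b∉ , _) = ⊥-elim (ℕ.<-irrefl refl (begin-strict
        length R            <⟨ Unique-⊆⇒length≤ _≟_ (¬Any⇒All¬ R b∉ ∷ uR) (λ {v} _ → complete v) ⟩
        length vertices     ≤⟨ bound ⟩
        length R + 0        ≡⟨ ℕ.+-identityʳ _ ⟩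
        length R            ∎))
        where open ℕ.≤-Reasoning
      loop (suc f) {R} uR bound t | inj₂ (b , b∉ , t′) =
        loop f (¬Any⇒All¬ R b∉ ∷ uR) (subst (length vertices ≤_) (ℕ.+-suc _ f) bound) t′

    spanningTree : (vertices : List V) → (∀ v → v ∈ vertices) → (S : List (V × V)) → All (uncurry E) S
      → (∀ u v → Star (Adj G S) u v) → ∃ λ T → SpanningTree G T × T ⊆ S
    spanningTree [] complete _ _ _ = [] , ([] , (λ u → ⊥-elim (¬Any[] (complete u))) , Acyclic-[]) , λ ()
    spanningTree vertices@(root ∷ others) complete S sound connected =
      let T , T⊆S , reach , acyclic = loop (length others) (All.[] ∷ []) ℕ.≤-refl tree₀
      in T , (All.tabulate (All.lookup sound ∘ T⊆S) , (λ u v → Star.reverse swap (reach u) ◅◅ reach v) , acyclic)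
           , T⊆S
      where
      open Prim vertices complete S root (connected root)
      tree₀ : Tree (root ∷ [])
      tree₀ = record { edges = [] ; edges⊆S = λ () ; inside = λ () ; root∈ = here refl
                     ; reach = λ { (here refl) → ε } ; acyclic = Acyclic-[] }

Covers : {A : Set} → List A → A → A → Set
Covers C x y = x ∈ C ⊎ y ∈ C

record Enumeration (G : Graph) : Set where
  open Graph G
  field
    _≟_ : DecidableEquality V
    vertices : List V
    ∈-vertices : ∀ v → v ∈ vertices
    edges : List (V × V)
    edges-sound : All (uncurry E) edges
    ∈-edges : ∀ {u v} → E u v → (u , v) ∈ edges

module _ (G : Graph) where
  open Graph G

  CoveredEdge : List V → V → V → Set
  CoveredEdge C x y = E x y × Covers C x y

  CoverConnects : List V → Set
  CoverConnects C = ∀ u v → EqClosure (CoveredEdge C) u v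

  HasConnectingCover : ℕ → Set
  HasConnectingCover k = Σ (List V) λ C → Unique C × length C ≤ k × CoverConnects C

  HasSTwithVC⇒HasConnectingCover : ∀ {k} → HasSTwithVC G k → HasConnectingCover k
  HasSTwithVC⇒HasConnectingCover (T , (sound , connected , _) , C , uC , |C|≤k , cover) =
    C , uC , |C|≤k , λ u v → Star.map covered (connected u v)
    where
    covered : ∀ {x y} → Adj G T x y → SymClosure (CoveredEdge C) x y
    covered (inj₁ p) = fwd (All.lookup sound p , cover _ _ p)
    covered (inj₂ p) = bwd (All.lookup sound p , cover _ _ p)

  HasConnectingCover⇒HasSTwithVC : Enumeration G → ∀ {k} → HasConnectingCover k → HasSTwithVC G k
  HasConnectingCover⇒HasSTwithVC enum (C , uC , |C|≤k , connects) =
    let T , tree , T⊆S = spanningTree G _≟_ vertices ∈-vertices S S-sound (λ u v → Star.map inS (connects u v))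
    in T , tree , C , uC , |C|≤k , λ _ _ uv∈T → proj₂ (∈-filter⁻ covers? {xs = edges} (T⊆S uv∈T))
    where
    open Enumeration enum
    open import Data.List.Membership.DecPropositional _≟_ using (_∈?_)
    covers? : Decidable (uncurry (Covers C))
    covers? (x , y) = x ∈? C ⊎-dec y ∈? C
    S : List (V × V)
    S = filter covers? edges
    S-sound : All (uncurry E) S
    S-sound = All.tabulate λ uv∈S → All.lookup edges-sound (proj₁ (∈-filter⁻ covers? {xs = edges} uv∈S))
    inS : ∀ {x y} → SymClosure (CoveredEdge C) x y → Adj G S x y
    inS (fwd (uv , c)) = inj₁ (∈-filter⁺ covers? (∈-edges uv) c)
    inS (bwd (vu , c)) = inj₂ (∈-filter⁺ covers? (∈-edges vu) c)

enumeration : ∀ {n} (Es : List (Fin n × Fin n)) → Enumeration (graphOf n Es)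
enumeration {n} Es = record
  { _≟_ = Fin._≟_ ; vertices = allFin n ; ∈-vertices = ∈-allFin
  ; edges = Es ; edges-sound = All.tabulate (λ e∈ → e∈) ; ∈-edges = λ e∈ → e∈ }

module _ {n : ℕ} (Es : List (Fin n × Fin n)) (pos : Fin n → Pt) where
  private
    αₑ : Fin (length Es) → ℕ
    αₑ = α Es pos

  edgeLength : Fin n × Fin n → ℕ
  edgeLength e = M pos (proj₁ e) (proj₂ e)

  ΣM : ℕ
  ΣM = sum (map edgeLength Es)

  ℓ s r : ∀ e → Fin (αₑ e) → V′ Es pos
  ℓ e i = new Es pos e i Fin.zero
  s e i = new Es pos e i (Fin.suc Fin.zero)
  r e i = new Es pos e i (Fin.suc (Fin.suc Fin.zero))

  Cell : Set
  Cell = Σ (Fin (length Es)) λ e → Fin (αₑ e)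

  cellsOf : Fin (length Es) → List Cell
  cellsOf e = tabulate (e ,_)

  length-cellsOf : ∀ e → length (cellsOf e) ≡ αₑ e
  length-cellsOf e = length-tabulate _

  cells : List Cell
  cells = concat (tabulate cellsOf)

  ∈-cells : ∀ c → c ∈ cells
  ∈-cells (e , i) = ∈-concat⁺′ (∈-tabulate⁺ i) (∈-tabulate⁺ e)

  cells-unique : Unique cells
  cells-unique = Unique.concat⁺ (All.tabulate⁺ λ _ → Unique.tabulate⁺ λ { refl → refl })
                                (AllPairs.tabulate⁺ disjoint)
    where
    disjoint : ∀ {e e′} → e ≢ e′ → ∀ {c} → ¬ (c ∈ cellsOf e × c ∈ cellsOf e′)
    disjoint e≢e′ (c∈ , c∈′) = e≢e′ (trans (sym (first-is c∈)) (first-is c∈′))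
      where
      first-is : ∀ {e c} → c ∈ cellsOf e → proj₁ c ≡ e
      first-is c∈ = cong proj₁ (proj₂ (∈-tabulate⁻ c∈))

  length-cells : length cells ≡ ΣM
  length-cells = begin
    length cells                                          ≡⟨ length-concat (tabulate cellsOf) ⟩
    sum (map length (tabulate cellsOf))                   ≡⟨ cong sum (map-tabulate cellsOf length) ⟩
    sum (tabulate (length ∘ cellsOf))                     ≡⟨ cong sum (tabulate-cong length-cellsOf) ⟩
    sum (tabulate αₑ)                                     ≡⟨ cong sum (map-tabulate (lookup Es) edgeLength) ⟨
    sum (map edgeLength (tabulate (lookup Es)))           ≡⟨ cong (sum ∘ map edgeLength) (tabulate-lookup Es) ⟩
    ΣM                                                    ∎
    where open ≡-Reasoning

  Edge′ : Set
  Edge′ = Σ (V′ Es pos × V′ Es pos) (uncurry (E′ Es pos))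

  private
    edgeIf : {P : Set} → Dec P → (P → Edge′) → List Edge′
    edgeIf (yes p) f = f p ∷ []
    edgeIf (no _) _ = []

    edgeIf-complete : ∀ {P : Set} {Q : Edge′ → Set} (d : Dec P) {f : P → Edge′} → P → (∀ p → Q (f p))
      → Any Q (edgeIf d f)
    edgeIf-complete (yes p) _ q = here (q p)
    edgeIf-complete (no ¬p) p _ = ⊥-elim (¬p p)

  triangleAt entryAt exitAt linksAt : ∀ e → Fin (αₑ e) → List Edge′
  triangleAt e i = (_ , ℓs e i) ∷ (_ , sr e i) ∷ (_ , rℓ e i) ∷ []
  entryAt e i = edgeIf (toℕ i ℕ.≟ 0) (λ p → _ , first e i p)
  exitAt e i = edgeIf (suc (toℕ i) ℕ.≟ αₑ e) (λ p → _ , last e i p)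
  linksAt e i = concat (tabulate λ j → edgeIf (suc (toℕ i) ℕ.≟ toℕ j) (λ p → _ , link e i j p))

  edgesAt : Cell → List Edge′
  edgesAt (e , i) = triangleAt e i ++ entryAt e i ++ exitAt e i ++ linksAt e i

  edgesAt-complete : ∀ {x y} → E′ Es pos x y → ∃ λ c → Any (λ g → (x , y) ≡ proj₁ g) (edgesAt c)
  edgesAt-complete (ℓs e i) = (e , i) , here refl
  edgesAt-complete (sr e i) = (e , i) , there (here refl)
  edgesAt-complete (rℓ e i) = (e , i) , there (there (here refl))
  edgesAt-complete (first e i p) =
    (e , i) , Any.++⁺ʳ (triangleAt e i) (Any.++⁺ˡ (edgeIf-complete (toℕ i ℕ.≟ 0) p λ _ → refl))
  edgesAt-complete (last e i p) =
    (e , i) , Any.++⁺ʳ (triangleAt e i) (Any.++⁺ʳ (entryAt e i)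
                (Any.++⁺ˡ (edgeIf-complete (suc (toℕ i) ℕ.≟ αₑ e) p λ _ → refl)))
  edgesAt-complete (link e i j p) =
    (e , i) , Any.++⁺ʳ (triangleAt e i) (Any.++⁺ʳ (entryAt e i) (Any.++⁺ʳ (exitAt e i)
                (Any.concat⁺ (Any.tabulate⁺ j (edgeIf-complete (suc (toℕ i) ℕ.≟ toℕ j) p λ _ → refl)))))

  enumeration′ : Enumeration (G′ Es pos)
  enumeration′ = record
    { _≟_ = ⊎-≡-dec Fin._≟_ (Σ-≡-dec Fin._≟_ (Σ-≡-dec Fin._≟_ Fin._≟_))
    ; vertices = map inj₁ (allFin n) ++ concat (map cellVertices cells)
    ; ∈-vertices = λ
        { (inj₁ w) → ∈-++⁺ˡ (∈-map⁺ inj₁ (∈-allFin w))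
        ; (inj₂ (e , i , t)) → ∈-++⁺ʳ _ (∈-concat⁺′ (∈-tabulate⁺ {f = new Es pos e i} t)
                                                    (∈-map⁺ cellVertices (∈-cells (e , i)))) }
    ; edges = map proj₁ allEdges
    ; edges-sound = All.map⁺ (All.universal proj₂ allEdges)
    ; ∈-edges = λ xy → let c , at = edgesAt-complete xy in
        Any.map⁺ {f = proj₁} (Any.concat⁺ (Any.map⁺ {f = edgesAt} (Any.map (λ { refl → at }) (∈-cells c))))
    }
    where
    cellVertices : Cell → List (V′ Es pos)
    cellVertices (e , i) = tabulate (new Es pos e i)
    allEdges : List Edge′
    allEdges = concat (map edgesAt cells)

  M≡0⇒pos≡ : ∀ {u v} → M pos u v ≡ 0 → pos u ≡ pos v
  M≡0⇒pos≡ M≡0 =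
    cong₂ _,_ (∣i-j∣≡0⇒i≡j (ℕ.m+n≡0⇒m≡0 _ M≡0)) (∣i-j∣≡0⇒i≡j (ℕ.m+n≡0⇒n≡0 _ M≡0))
    where
    ∣i-j∣≡0⇒i≡j : ∀ {i j} → ∣ i - j ∣ ≡ 0 → i ≡ j
    ∣i-j∣≡0⇒i≡j {i} {j} ∣i-j∣≡0 = ℤ.i-j≡0⇒i≡j i j (ℤ.∣i∣≡0⇒i≡0 ∣i-j∣≡0)

  α-positive : SimpleEdgeList Es → Injective _≡_ _≡_ pos → ∀ e → 1 ≤ αₑ e
  α-positive (_ , loopless , _) injective e =
    ℕ.n≢0⇒n>0 λ α≡0 → loopless _ _ (∈-lookup e) (injective (M≡0⇒pos≡ α≡0))

  base : V′ Es pos → Fin n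
  base (inj₁ w) = w
  base (inj₂ (e , _)) = src Es e

  CoversGadget : List (Fin n) → List (V′ Es pos) → Fin (length Es) → Set
  CoversGadget C C′ e = (src Es e ∈ C × ∀ i → r e i ∈ C′) ⊎ (src Es e ∉ C × ∀ i → ℓ e i ∈ C′)

  module Lift (C : List (Fin n)) (C′ : List (V′ Es pos)) (C⊆C′ : ∀ {w} → w ∈ C → inj₁ w ∈ C′)
              (chosen : ∀ e → CoversGadget C C′ e) (α≥1 : ∀ e → 1 ≤ αₑ e) where

    private
      Path : V′ Es pos → V′ Es pos → Set
      Path = EqClosure (CoveredEdge (G′ Es pos) C′)

    entry-covered : ∀ e i → Covers C′ (inj₁ (src Es e)) (ℓ e i)
    entry-covered e i with chosen e
    ... | inj₁ (src∈ , _) = inj₁ (C⊆C′ src∈)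
    ... | inj₂ (_ , ℓ∈) = inj₂ (ℓ∈ i)

    triangle-covered : ∀ e i → Covers C′ (r e i) (ℓ e i)
    triangle-covered e i with chosen e
    ... | inj₁ (_ , r∈) = inj₁ (r∈ i)
    ... | inj₂ (_ , ℓ∈) = inj₂ (ℓ∈ i)

    link-covered : ∀ e i j → Covers C′ (r e i) (ℓ e j)
    link-covered e i j with chosen e
    ... | inj₁ (_ , r∈) = inj₁ (r∈ i)
    ... | inj₂ (_ , ℓ∈) = inj₂ (ℓ∈ j)

    exit-covered : ∀ e i → Covers C (src Es e) (tgt Es e) → Covers C′ (r e i) (inj₁ (tgt Es e))
    exit-covered e i covered with chosen e | covered
    ... | inj₁ (_ , r∈) | _ = inj₁ (r∈ i)
    ... | inj₂ (src∉ , _) | inj₁ src∈ = ⊥-elim (src∉ src∈)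
    ... | inj₂ _ | inj₂ tgt∈ = inj₂ (C⊆C′ tgt∈)

    ℓ⇝s : ∀ e i → Path (ℓ e i) (s e i)
    ℓ⇝s e i with chosen e
    ... | inj₁ (_ , r∈) = bwd (rℓ e i , inj₁ (r∈ i)) ◅ bwd (sr e i , inj₂ (r∈ i)) ◅ ε
    ... | inj₂ (_ , ℓ∈) = fwd (ℓs e i , inj₁ (ℓ∈ i)) ◅ ε

    ℓ⇝r : ∀ e i → Path (ℓ e i) (r e i)
    ℓ⇝r e i = bwd (rℓ e i , triangle-covered e i) ◅ ε

    src⇝ℓ : ∀ e i → Path (inj₁ (src Es e)) (ℓ e i)
    src⇝ℓ e = toℕ-induction _
      (λ i i≡0 → fwd (first e i i≡0 , entry-covered e i) ◅ ε)
      (λ i j i+1≡j src⇝ℓᵢ →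
         src⇝ℓᵢ ◅◅ ℓ⇝r e i ◅◅ fwd (link e i j i+1≡j , link-covered e i j) ◅ ε)

    src⇝gadget : ∀ e i t → Path (inj₁ (src Es e)) (new Es pos e i t)
    src⇝gadget e i Fin.zero = src⇝ℓ e i
    src⇝gadget e i (Fin.suc Fin.zero) = src⇝ℓ e i ◅◅ ℓ⇝s e i
    src⇝gadget e i (Fin.suc (Fin.suc Fin.zero)) = src⇝ℓ e i ◅◅ ℓ⇝r e i

    src⇝tgt : ∀ e → Covers C (src Es e) (tgt Es e) → Path (inj₁ (src Es e)) (inj₁ (tgt Es e))
    src⇝tgt e covered =
      let i , i+1≡α = ∃-toℕ≡pred (α≥1 e)
      in src⇝gadget e i _ ◅◅ fwd (last e i i+1≡α , exit-covered e i covered) ◅ ε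

    covered⇝ : ∀ {u v} → CoveredEdge (graphOf n Es) C u v → Path (inj₁ u) (inj₁ v)
    covered⇝ (uv∈Es , covered) with Any.index uv∈Es | Any.lookup-index uv∈Es
    ... | e | refl = src⇝tgt e covered

    base⇝ : ∀ x → Path (inj₁ (base x)) x
    base⇝ (inj₁ w) = ε
    base⇝ (inj₂ (e , i , t)) = src⇝gadget e i t

    CoverConnects-lift : CoverConnects (graphOf n Es) C → CoverConnects (G′ Es pos) C′
    CoverConnects-lift connects x y =
      EqClosure.symmetric _ (base⇝ x)
      ◅◅ EqClosure.gfold (EqClosure.isEquivalence _) inj₁ covered⇝ (connects (base x) (base y))
      ◅◅ base⇝ y

  private
    tagFor : {P : Set} → Dec P → Fin 3
    tagFor (yes _) = Fin.suc (Fin.suc Fin.zero)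
    tagFor (no _) = Fin.zero

  module _ (C : List (Fin n)) where
    open import Data.List.Membership.DecPropositional (Fin._≟_ {n}) using (_∈?_)

    chosenVertex : Cell → V′ Es pos
    chosenVertex (e , i) = new Es pos e i (tagFor (src Es e ∈? C))

    liftCover : List (V′ Es pos)
    liftCover = map inj₁ C ++ map chosenVertex cells

    liftCover-unique : Unique C → Unique liftCover
    liftCover-unique uC = Unique.++⁺ (Unique.map⁺ inj₁-injective uC) (Unique.map⁺ injective cells-unique) disjoint
      where
      injective : ∀ {c c′} → chosenVertex c ≡ chosenVertex c′ → c ≡ c′
      injective {_ , _} {_ , _} refl = refl
      disjoint : ∀ {x} → ¬ (x ∈ map inj₁ C × x ∈ map chosenVertex cells)
      disjoint (x∈ , x∈′) with ∈-map⁻ inj₁ x∈ | ∈-map⁻ chosenVertex x∈′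
      ... | _ , _ , refl | _ , _ , ()

    length-liftCover : length liftCover ≡ length C + ΣM
    length-liftCover = trans (length-++ (map inj₁ C))
      (cong₂ _+_ (length-map inj₁ C) (trans (length-map chosenVertex cells) length-cells))

    liftCover-covers : ∀ e → CoversGadget C liftCover e
    liftCover-covers e =
      byDecision (src Es e ∈? C) λ i → ∈-++⁺ʳ (map inj₁ C) (∈-map⁺ chosenVertex (∈-cells (e , i)))
      where
      byDecision : (d : Dec (src Es e ∈ C)) → (∀ i → new Es pos e i (tagFor d) ∈ liftCover)
        → CoversGadget C liftCover e
      byDecision (yes src∈) chosen∈ = inj₁ (src∈ , chosen∈)
      byDecision (no src∉) chosen∈ = inj₂ (src∉ , chosen∈)

  HasConnectingCover-lift : (∀ e → 1 ≤ αₑ e) → ∀ {k}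
    → HasConnectingCover (graphOf n Es) k → HasConnectingCover (G′ Es pos) (k + ΣM)
  HasConnectingCover-lift α≥1 {k} (C , uC , |C|≤k , connects) =
      liftCover C
    , liftCover-unique C uC
    , subst (_≤ k + ΣM) (sym (length-liftCover C)) (ℕ.+-monoˡ-≤ ΣM |C|≤k)
    , Lift.CoverConnects-lift C (liftCover C) (∈-++⁺ˡ ∘ ∈-map⁺ inj₁) (liftCover-covers C) α≥1 connects

  module Contract (C′ : List (V′ Es pos)) (connects : CoverConnects (G′ Es pos) C′) where
    open import Data.List.Membership.DecPropositional (Enumeration._≟_ enumeration′)
      using () renaming (_∈?_ to _∈′?_)
    open import Data.List.Membership.DecPropositional (Fin._≟_ {n}) using (_∈?_)

    private
      inTriangle : ∀ {e i t t′} → Covers C′ (new Es pos e i t) (new Es pos e i t′)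
        → ∃ λ t → new Es pos e i t ∈ C′
      inTriangle (inj₁ x∈) = _ , x∈
      inTriangle (inj₂ y∈) = _ , y∈

    hit : ∀ e i → ∃ λ t → new Es pos e i t ∈ C′
    hit e i with connects (s e i) (inj₁ (src Es e))
    ... | fwd (sr _ _ , covered) ◅ _ = inTriangle covered
    ... | bwd (ℓs _ _ , covered) ◅ _ = inTriangle covered

    rep : Cell → V′ Es pos
    rep (e , i) = new Es pos e i (proj₁ (hit e i))

    IsRep : V′ Es pos → Set
    IsRep (inj₁ _) = ⊥
    IsRep (inj₂ (e , i , t)) = t ≡ proj₁ (hit e i)

    isRep? : Decidable IsRep
    isRep? (inj₁ _) = no λ ()
    isRep? (inj₂ (e , i , t)) = t Fin.≟ proj₁ (hit e i)

    nonReps : List (V′ Es pos)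
    nonReps = filter (¬? ∘ isRep?) C′

    contractCover : List (Fin n)
    contractCover = deduplicate Fin._≟_ (map base nonReps)

    base∈contractCover : ∀ {x} → x ∈ C′ → ¬ IsRep x → base x ∈ contractCover
    base∈contractCover x∈ ¬rep =
      ∈-deduplicate⁺ Fin._≟_ (∈-map⁺ base (∈-filter⁺ (¬? ∘ isRep?) x∈ ¬rep))

    contractCover-length : ∀ {k} → length C′ ≤ k + ΣM → length contractCover ≤ k
    contractCover-length {k} |C′|≤k+ΣM = ℕ.+-cancelʳ-≤ ΣM _ k (begin
      length contractCover + ΣM                   ≤⟨ ℕ.+-mono-≤ |contractCover|≤ ΣM≤ ⟩
      length nonReps + length (filter isRep? C′)  ≡⟨ ℕ.+-comm _ (length (filter isRep? C′)) ⟩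
      length (filter isRep? C′) + length nonReps  ≡⟨ length-filter+length-filter¬ isRep? C′ ⟩
      length C′                                   ≤⟨ |C′|≤k+ΣM ⟩
      k + ΣM                                      ∎)
      where
      open ℕ.≤-Reasoning
      |contractCover|≤ : length contractCover ≤ length nonReps
      |contractCover|≤ = ℕ.≤-trans (length-deduplicate Fin._≟_ (map base nonReps))
                                   (ℕ.≤-reflexive (length-map base nonReps))
      reps-unique : Unique (map rep cells)
      reps-unique = Unique.map⁺ (λ { {_ , _} {_ , _} refl → refl }) cells-unique
      reps⊆ : map rep cells ⊆ filter isRep? C′
      reps⊆ x∈ with ∈-map⁻ rep x∈
      ... | (e , i) , _ , refl = ∈-filter⁺ isRep? (proj₂ (hit e i)) refl
      ΣM≤ : ΣM ≤ length (filter isRep? C′)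
      ΣM≤ = begin
        ΣM                         ≡⟨ length-cells ⟨
        length cells               ≡⟨ length-map rep cells ⟨
        length (map rep cells)     ≤⟨ Unique-⊆⇒length≤ (Enumeration._≟_ enumeration′) reps-unique reps⊆ ⟩
        length (filter isRep? C′)  ∎

    inj₁∉ : ∀ {w} → w ∉ contractCover → inj₁ w ∉ C′
    inj₁∉ w∉ w∈ = w∉ (base∈contractCover w∈ λ ())

    onlyRep : ∀ {e i t} → src Es e ∉ contractCover → new Es pos e i t ∈ C′ → t ≡ proj₁ (hit e i)
    onlyRep {e} {i} {t} src∉ t∈ with isRep? (new Es pos e i t)
    ... | yes t≡ = t≡
    ... | no ¬rep = ⊥-elim (src∉ (base∈contractCover t∈ ¬rep))

    ℓ∈⇒r∉ : ∀ {e i} → src Es e ∉ contractCover → ℓ e i ∈ C′ → r e i ∉ C′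
    ℓ∈⇒r∉ src∉ ℓ∈ r∈ with () ← trans (onlyRep src∉ ℓ∈) (sym (onlyRep src∉ r∈))

    LeftRun : ∀ e → Fin (αₑ e) → Set
    LeftRun e i = ∀ j → toℕ j ≤ toℕ i → ℓ e j ∈ C′

    leftRun? : ∀ e i → Dec (LeftRun e i)
    leftRun? e i = Fin.all? λ j → toℕ j ℕ.≤? toℕ i →-dec ℓ e j ∈′? C′

    LeftRun-entry : ∀ {e i} → toℕ i ≡ 0 → ℓ e i ∈ C′ → LeftRun e i
    LeftRun-entry {e} i≡0 ℓ∈ j j≤i =
      subst (λ k → ℓ e k ∈ C′) (Fin.toℕ-injective (trans i≡0 (sym j≡0))) ℓ∈
      where
      j≡0 : toℕ j ≡ 0
      j≡0 = ℕ.n≤0⇒n≡0 (subst (toℕ j ≤_) i≡0 j≤i)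

    LeftRun-pred : ∀ {e i j} → suc (toℕ i) ≡ toℕ j → LeftRun e j → LeftRun e i
    LeftRun-pred i+1≡j run k k≤i =
      run k (ℕ.≤-trans k≤i (ℕ.≤-trans (ℕ.n≤1+n _) (ℕ.≤-reflexive i+1≡j)))

    LeftRun-suc : ∀ {e i j} → suc (toℕ i) ≡ toℕ j → LeftRun e i → ℓ e j ∈ C′ → LeftRun e j
    LeftRun-suc {e} i+1≡j run ℓⱼ∈ k k≤j with ℕ.m≤n⇒m<n∨m≡n k≤j
    ... | inj₁ k<j = run k (ℕ.≤-pred (subst (suc (toℕ k) ≤_) (sym i+1≡j) k<j))
    ... | inj₂ k≡j = subst (λ x → ℓ e x ∈ C′) (sym (Fin.toℕ-injective k≡j)) ℓⱼ∈

    side : ∀ e → Fin (αₑ e) → Fin n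
    side e i with leftRun? e i
    ... | yes _ = src Es e
    ... | no _ = tgt Es e

    side-src : ∀ {e i} → LeftRun e i → side e i ≡ src Es e
    side-src {e} {i} run with leftRun? e i
    ... | yes _ = refl
    ... | no ¬run = ⊥-elim (¬run run)

    side-tgt : ∀ {e i} → ¬ LeftRun e i → side e i ≡ tgt Es e
    side-tgt {e} {i} ¬run with leftRun? e i
    ... | yes run = ⊥-elim (¬run run)
    ... | no _ = refl

    side-end : ∀ e i → side e i ≡ src Es e ⊎ side e i ≡ tgt Es e
    side-end e i with leftRun? e i
    ... | yes _ = inj₁ refl
    ... | no _ = inj₂ refl

    side-cong : ∀ {e i j} → (LeftRun e i → LeftRun e j) → (LeftRun e j → LeftRun e i) → side e i ≡ side e j
    side-cong {e} {i} {j} i⇒j j⇒i with leftRun? e i | leftRun? e j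
    ... | yes _ | yes _ = refl
    ... | no _ | no _ = refl
    ... | yes runᵢ | no ¬runⱼ = ⊥-elim (¬runⱼ (i⇒j runᵢ))
    ... | no ¬runᵢ | yes runⱼ = ⊥-elim (¬runᵢ (j⇒i runⱼ))

    private
      Path : Fin n → Fin n → Set
      Path = EqClosure (CoveredEdge (graphOf n Es) contractCover)

      ≡⇒Path : ∀ {u v} → u ≡ v → Path u v
      ≡⇒Path refl = ε

      ends-connected : ∀ e → Covers contractCover (src Es e) (tgt Es e) → ∀ {u v}
        → u ≡ src Es e ⊎ u ≡ tgt Es e → v ≡ src Es e ⊎ v ≡ tgt Es e → Path u v
      ends-connected e covered (inj₁ refl) (inj₁ refl) = ε
      ends-connected e covered (inj₁ refl) (inj₂ refl) = fwd (∈-lookup e , covered) ◅ ε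
      ends-connected e covered (inj₂ refl) (inj₁ refl) = bwd (∈-lookup e , covered) ◅ ε
      ends-connected e covered (inj₂ refl) (inj₂ refl) = ε

    within-edge : ∀ e {u v} → u ≡ src Es e ⊎ u ≡ tgt Es e → v ≡ src Es e ⊎ v ≡ tgt Es e
      → (src Es e ∉ contractCover → tgt Es e ∉ contractCover → u ≡ v) → Path u v
    within-edge e u-end v-end uncovered with src Es e ∈? contractCover | tgt Es e ∈? contractCover
    ... | yes src∈ | _ = ends-connected e (inj₁ src∈) u-end v-end
    ... | no _ | yes tgt∈ = ends-connected e (inj₂ tgt∈) u-end v-end
    ... | no src∉ | no tgt∉ = ≡⇒Path (uncovered src∉ tgt∉)

    entry-side : ∀ {e i} → toℕ i ≡ 0 → Covers C′ (inj₁ (src Es e)) (ℓ e i) → src Es e ∉ contractCover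
      → src Es e ≡ side e i
    entry-side _ (inj₁ src∈) src∉ = ⊥-elim (inj₁∉ src∉ src∈)
    entry-side i≡0 (inj₂ ℓ∈) _ = sym (side-src (LeftRun-entry i≡0 ℓ∈))

    exit-side : ∀ {e i} → Covers C′ (r e i) (inj₁ (tgt Es e))
      → src Es e ∉ contractCover → tgt Es e ∉ contractCover → side e i ≡ tgt Es e
    exit-side (inj₁ r∈) src∉ _ = side-tgt λ run → ℓ∈⇒r∉ src∉ (run _ ℕ.≤-refl) r∈
    exit-side (inj₂ tgt∈) _ tgt∉ = ⊥-elim (inj₁∉ tgt∉ tgt∈)

    link-side : ∀ {e i j} → suc (toℕ i) ≡ toℕ j → Covers C′ (r e i) (ℓ e j) → src Es e ∉ contractCover
      → side e i ≡ side e j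
    link-side {e} {i} i+1≡j (inj₁ r∈) src∉ =
      trans (side-tgt ¬runᵢ) (sym (side-tgt (¬runᵢ ∘ LeftRun-pred i+1≡j)))
      where
      ¬runᵢ : ¬ LeftRun e i
      ¬runᵢ run = ℓ∈⇒r∉ src∉ (run _ ℕ.≤-refl) r∈
    link-side i+1≡j (inj₂ ℓⱼ∈) _ = side-cong (λ run → LeftRun-suc i+1≡j run ℓⱼ∈) (LeftRun-pred i+1≡j)

    contract : V′ Es pos → Fin n
    contract (inj₁ w) = w
    contract (inj₂ (e , i , _)) = side e i

    contract-edge : ∀ {x y} → CoveredEdge (G′ Es pos) C′ x y → Path (contract x) (contract y)
    contract-edge (ℓs _ _ , _) = ε
    contract-edge (sr _ _ , _) = ε
    contract-edge (rℓ _ _ , _) = ε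
    contract-edge (first e i i≡0 , covered) =
      within-edge e (inj₁ refl) (side-end e i) λ src∉ _ → entry-side i≡0 covered src∉
    contract-edge (last e i _ , covered) =
      within-edge e (side-end e i) (inj₂ refl) (exit-side covered)
    contract-edge (link e i j i+1≡j , covered) =
      within-edge e (side-end e i) (side-end e j) λ src∉ _ → link-side i+1≡j covered src∉

    CoverConnects-contract : CoverConnects (graphOf n Es) contractCover
    CoverConnects-contract u v =
      EqClosure.gfold (EqClosure.isEquivalence _) contract contract-edge (connects (inj₁ u) (inj₁ v))

  HasConnectingCover-contract : ∀ {k}
    → HasConnectingCover (G′ Es pos) (k + ΣM) → HasConnectingCover (graphOf n Es) k
  HasConnectingCover-contract (C′ , _ , |C′|≤k+ΣM , connects) =
    contractCover , deduplicate-! Fin._≟_ _ , contractCover-length |C′|≤k+ΣM , CoverConnects-contract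
    where open Contract C′ connects

-- The degree bound, the drawing and k ≥ 1 matter only for the paper's hardness
-- reduction; the equivalence holds without them.
lemma5 : (n : ℕ) (Es : List (Fin n × Fin n)) (pos : Fin n → Pt) (k : ℕ)
    → SimpleEdgeList Es
    → Injective _≡_ _≡_ pos
    → (∀ v → degree Es v ≤ 4)
    → OrthoDrawing Es pos
    → 1 ≤ k
    → HasSTwithVC (graphOf n Es) k
      ⇔ HasSTwithVC (G′ Es pos) (k + sum (map (λ e → M pos (proj₁ e) (proj₂ e)) Es))
lemma5 n Es pos k simple injective _ _ _ = mk⇔
  (HasConnectingCover⇒HasSTwithVC (G′ Es pos) (enumeration′ Es pos)
    ∘ HasConnectingCover-lift Es pos (α-positive Es pos simple injective)
    ∘ HasSTwithVC⇒HasConnectingCover (graphOf n Es))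
  (HasConnectingCover⇒HasSTwithVC (graphOf n Es) (enumeration Es)
    ∘ HasConnectingCover-contract Es pos
    ∘ HasSTwithVC⇒HasConnectingCover (G′ Es pos))
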